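{- For every $n\ge 4$, the star $S_n=K_{n-1,1}$ is $\mathcal{P}$-unique.
   Context: Graphs are finite and simple. For $S\subseteq V(G)$, $S$ is a power dominating set if, after coloring $S$, coloring every neighbor of a vertex of $S$, and then repeatedly applying the forcing rule (a colored vertex with exactly one uncolored neighbor colors that neighbor) until no changes occur, all vertices are colored. $\mathcal{P}(G;x)=\sum_{i=1}^{|V(G)|}p(G;i)x^i$, where $p(G;i)$ is the number of power dominating sets of size $i$. A graph $G$ is $\mathcal{P}$-unique if every graph $H$ with $\mathcal{P}(H;x)=\mathcal{P}(G;x)$ is isomorphic to $G$. -}

module Defs where

open import Data.Bool using (Bool; true; false; _∧_; _∨_; not; if_then_else_)
open import Data.Nat using (ℕ; zero; suc; _≡ᵇ_)
open import Data.Fin using (Fin; zero; suc; _≟_)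
open import Data.Fin.Subset using (Subset; ∣_∣)
open import Data.Vec using (Vec; []; _∷_; lookup; tabulate)
open import Data.List using (List; []; _∷_; _++_; map; allFin; length; filter)
open import Data.Bool.ListAction using (all; any)
open import Data.Product using (Σ; _×_)
open import Function.Bundles using (_↔_; Inverse)
open import Relation.Nullary.Decidable using (⌊_⌋)
open import Relation.Binary.PropositionalEquality using (_≡_)

record Graph (n : ℕ) : Set where
  field
    adj    : Fin n → Fin n → Bool
    sym    : ∀ i j → adj i j ≡ adj j i
    irrefl : ∀ i → adj i i ≡ false
open Graph public

allV : ∀ {n} → (Fin n → Bool) → Bool
allV {n} p = all p (allFin n)

anyV : ∀ {n} → (Fin n → Bool) → Bool
anyV {n} p = any p (allFin n)

module _ {n : ℕ} (G : Graph n) where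

  closedNbhd : Subset n → Subset n
  closedNbhd S = tabulate λ v → lookup S v ∨ anyV (λ u → lookup S u ∧ adj G u v)

  forces : Subset n → Fin n → Fin n → Bool
  forces c u v = lookup c u ∧ adj G u v ∧ not (lookup c v)
                 ∧ allV (λ w → not (adj G u w) ∨ ⌊ w ≟ v ⌋ ∨ lookup c w)

  forceStep : Subset n → Subset n
  forceStep c = tabulate λ v → lookup c v ∨ anyV (λ u → forces c u v)

  iterate : ℕ → Subset n → Subset n
  iterate zero    c = c
  iterate (suc k) c = iterate k (forceStep c)

  -- the final coloured set: the forcing process stabilises after at most n
  -- rounds (each effective round colours at least one new vertex)
  observed : Subset n → Subset n
  observed S = iterate n (closedNbhd S)

  isPowerDominating : Subset n → Bool
  isPowerDominating S = allV (λ v → lookup (observed S) v)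

allSubsets : (n : ℕ) → List (Subset n)
allSubsets zero    = [] ∷ []
allSubsets (suc n) = map (true ∷_) (allSubsets n) ++ map (false ∷_) (allSubsets n)

pdCount : ∀ {n} → Graph n → ℕ → ℕ
pdCount {n} G i =
  length (filter (λ S → Data.Bool.T? ((∣ S ∣ ≡ᵇ i) ∧ isPowerDominating G S)) (allSubsets n))
  where import Data.Bool

-- coefficient of x^i in the power domination polynomial P(G;x) = Σ_{i≥1} p(G;i) x^i
pdCoeff : ∀ {n} → Graph n → ℕ → ℕ
pdCoeff G zero    = 0
pdCoeff G (suc i) = pdCount G (suc i)

SamePDPoly : ∀ {n m} → Graph n → Graph m → Set
SamePDPoly G H = ∀ i → pdCoeff G i ≡ pdCoeff H i

Isomorphic : ∀ {n m} → Graph n → Graph m → Set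
Isomorphic {n} {m} G H =
  Σ (Fin n ↔ Fin m) λ f → ∀ i j → adj G i j ≡ adj H (Inverse.to f i) (Inverse.to f j)

PUnique : ∀ {n} → Graph n → Set
PUnique G = ∀ m (H : Graph m) → SamePDPoly H G → Isomorphic H G

-- the star S_n = K_{n-1,1} on Fin n, with centre vertex 0
isCentre : ∀ {n} → Fin n → Bool
isCentre zero    = true
isCentre (suc _) = false

starAdj : ∀ {n} → Fin n → Fin n → Bool
starAdj i j = (isCentre i ∧ not (isCentre j)) ∨ (not (isCentre i) ∧ isCentre j)

star : (n : ℕ) → Graph n
star n = record { adj = starAdj ; sym = symP ; irrefl = irr }
  where
  symP : ∀ (i j : Fin n) → starAdj i j ≡ starAdj j i
  symP zero    zero    = Relation.Binary.PropositionalEquality.refl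
  symP zero    (suc j) = Relation.Binary.PropositionalEquality.refl
  symP (suc i) zero    = Relation.Binary.PropositionalEquality.refl
  symP (suc i) (suc j) = Relation.Binary.PropositionalEquality.refl
  irr : ∀ (i : Fin n) → starAdj i i ≡ false
  irr zero    = Relation.Binary.PropositionalEquality.refl
  irr (suc i) = Relation.Binary.PropositionalEquality.refl

module Submission where

-- Let H have the same power domination polynomial as S_n.  The argument follows
-- the paper and has three ingredients.
--   * Order: the whole vertex set is always power dominating and no set is larger,
--     so the top nonzero coefficient of P(G;x) sits at |G|; hence |H| = n.
--   * A dominating vertex: p(S_n;1) ≥ 1 (the centre), so H has a power dominating
--     set S₁ ⊆ {v}.  Supersets of power dominating sets are power dominating.
--   * Counting (n-3)-sets: in S_n a set of size n-3 is power dominating iff it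
--     contains the centre (otherwise two leaves are undominated twins and are never
--     forced).  In H every (n-3)-set containing v is power dominating, and there are
--     equally many (n-3)-sets containing v as containing the centre, so equality of
--     p(·;n-3) means no (n-3)-set avoiding v is power dominating.
-- From the last fact, for an edge ab avoiding v and a fourth vertex c, the set
-- V ∖ {v,a,c} dominates neither v nor c, so {v,c} is closed under neighbours; since
-- colour started at v never leaves a closed set, {v,c} = V, a contradiction.  So no
-- edge avoids v, every vertex has a neighbour, and H is the star centred at v.

open import Defs hiding (sym)
open import Data.Nat using (ℕ; zero; suc; _+_; _≤_; _<_; z≤n; s≤s; _≡ᵇ_)
open import Data.Nat.Properties
  using (≤-refl; ≤-antisym; <-irrefl; m≤n⇒m≤1+n; suc-injective; +-identityʳ; ≡ᵇ⇒≡; ≡⇒≡ᵇ)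
open import Data.Bool using (Bool; true; false; T; _∧_; _∨_; not)
open import Data.Bool.Properties using (∧-identityʳ; ∧-zeroʳ)
open import Data.Unit using (tt)
open import Data.Empty using (⊥-elim)
open import Data.Product using (∃; _×_; _,_; proj₁; proj₂)
open import Data.Sum using (_⊎_; inj₁; inj₂; [_,_]′)
import Data.Sum as Sum
open import Data.Fin using (Fin; zero; suc; _≟_)
open import Data.Fin.Properties using (any?) renaming (suc-injective to Fin-suc-injective)
open import Data.Fin.Subset using (Subset; ∣_∣; ⊤) renaming (⊥ to ∅)
open import Data.Fin.Subset.Properties using (∣⊤∣≡n; ∣⊥∣≡0; ∣p∣≤n)
open import Data.Fin.Permutation using (transpose)
import Data.Fin.Permutation.Components as Components
open import Data.Vec using ([]; _∷_; lookup; tabulate; _[_]≔_)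
open import Data.Vec.Properties using (lookup∘tabulate; lookup∘update; lookup∘update′; lookup-replicate)
open import Data.List using (List; []; _∷_; _++_; map; filter; length; allFin)
open import Data.List.Properties using (filter-++; length-++; filter-some)
open import Data.List.Membership.Propositional using (_∈_; lose)
open import Data.List.Membership.Propositional.Properties using (∈-allFin; ∈-++⁺ˡ; ∈-++⁺ʳ; ∈-map⁺)
open import Data.List.Relation.Unary.Any using (here; there; satisfied)
import Data.List.Relation.Unary.All as All
open import Data.List.Relation.Unary.All.Properties using (all⁺; all⁻)
open import Data.List.Relation.Unary.Any.Properties using (any⁺; any⁻)
open import Function using (_∘_)
open import Relation.Nullary using (¬_; yes; no)
open import Relation.Nullary.Decidable using (⌊_⌋; T?; toWitness; fromWitness; toSum)
open import Relation.Binary.PropositionalEquality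
  using (_≡_; _≢_; refl; sym; trans; cong; cong₂; subst; module ≡-Reasoning)

T-∧⁻ : ∀ x {y} → T (x ∧ y) → T x × T y
T-∧⁻ true h = tt , h

T-∧⁺ : ∀ {x y} → T x → T y → T (x ∧ y)
T-∧⁺ {true} _ h = h

T-∨⁻ : ∀ x {y} → T (x ∨ y) → T x ⊎ T y
T-∨⁻ true  h = inj₁ tt
T-∨⁻ false h = inj₂ h

T-∨⁺ˡ : ∀ {x} y → T x → T (x ∨ y)
T-∨⁺ˡ {true} y _ = tt

T-∨⁺ʳ : ∀ x {y} → T y → T (x ∨ y)
T-∨⁺ʳ true  _ = tt
T-∨⁺ʳ false h = h

T-not : ∀ {x} → ¬ T x → T (not x)
T-not {true}  h = h tt
T-not {false} h = tt

T-not⁻ : ∀ {x} → T (not x) → ¬ T x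
T-not⁻ {true} ()

¬T⇒≡false : ∀ {x} → ¬ T x → x ≡ false
¬T⇒≡false {true}  h = ⊥-elim (h tt)
¬T⇒≡false {false} h = refl

T⇒≡true : ∀ {x} → T x → x ≡ true
T⇒≡true {true} _ = refl

∧-congˡ : ∀ x {y z} → (T x → y ≡ z) → x ∧ y ≡ x ∧ z
∧-congˡ true  eq = eq tt
∧-congˡ false eq = refl

count : {A : Set} → (A → Bool) → List A → ℕ
count p xs = length (filter (T? ∘ p) xs)

module _ {A : Set} where

  count-++ : ∀ (p : A → Bool) xs ys → count p (xs ++ ys) ≡ count p xs + count p ys
  count-++ p xs ys = trans (cong length (filter-++ (T? ∘ p) xs ys)) (length-++ (filter (T? ∘ p) xs))

  count-map : ∀ {B : Set} (p : A → Bool) (f : B → A) xs → count p (map f xs) ≡ count (p ∘ f) xs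
  count-map p f []       = refl
  count-map p f (x ∷ xs) with p (f x)
  ... | true  = cong suc (count-map p f xs)
  ... | false = count-map p f xs

  count-cong : ∀ {p q : A → Bool} → (∀ x → p x ≡ q x) → ∀ xs → count p xs ≡ count q xs
  count-cong {p} {q} p≡q []       = refl
  count-cong {p} {q} p≡q (x ∷ xs) with p x | q x | p≡q x
  ... | true  | true  | refl = cong suc (count-cong p≡q xs)
  ... | false | false | refl = count-cong p≡q xs

  count-false : ∀ xs → count (λ (_ : A) → false) xs ≡ 0
  count-false []       = refl
  count-false (x ∷ xs) = count-false xs

  count-mono : ∀ {p q : A → Bool} → (∀ x → T (p x) → T (q x)) → ∀ xs → count p xs ≤ count q xs
  count-mono {p} {q} p⇒q []       = z≤n
  count-mono {p} {q} p⇒q (x ∷ xs) with p x | q x | p⇒q x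
  ... | true  | true  | _ = s≤s (count-mono p⇒q xs)
  ... | true  | false | h = ⊥-elim (h tt)
  ... | false | true  | _ = m≤n⇒m≤1+n (count-mono p⇒q xs)
  ... | false | false | _ = count-mono p⇒q xs

  count-< : ∀ {p q : A → Bool} → (∀ x → T (p x) → T (q x)) →
            ∀ {y} xs → y ∈ xs → ¬ T (p y) → T (q y) → count p xs < count q xs
  count-< {p} {q} p⇒q (x ∷ xs) (here refl) ¬py qy with p x | q x
  ... | true  | _     = ⊥-elim (¬py tt)
  ... | false | true  = s≤s (count-mono p⇒q xs)
  count-< {p} {q} p⇒q (x ∷ xs) (there y∈) ¬py qy with p x | q x | p⇒q x
  ... | true  | true  | _ = s≤s (count-< p⇒q xs y∈ ¬py qy)
  ... | true  | false | h = ⊥-elim (h tt)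
  ... | false | true  | _ = m≤n⇒m≤1+n (count-< p⇒q xs y∈ ¬py qy)
  ... | false | false | _ = count-< p⇒q xs y∈ ¬py qy

  count-witness : ∀ (p : A → Bool) xs → 0 < count p xs → ∃ λ x → T (p x)
  count-witness p (x ∷ xs) pos with p x in px
  ... | true  = x , subst T (sym px) tt
  ... | false = count-witness p xs pos

  count-member : ∀ (p : A → Bool) {x} xs → x ∈ xs → T (p x) → 0 < count p xs
  count-member p xs x∈ px = filter-some (T? ∘ p) (lose x∈ px)

allV⁻ : ∀ {n} {p : Fin n → Bool} → T (allV p) → ∀ x → T (p x)
allV⁻ {n} {p} h x = All.lookup (all⁺ p (allFin n) h) (∈-allFin x)

allV⁺ : ∀ {n} {p : Fin n → Bool} → (∀ x → T (p x)) → T (allV p)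
allV⁺ {n} {p} h = all⁻ p {allFin n} (All.tabulate (λ {x} _ → h x))

anyV⁻ : ∀ {n} {p : Fin n → Bool} → T (anyV p) → ∃ λ x → T (p x)
anyV⁻ {n} {p} h = satisfied (any⁻ p (allFin n) h)

anyV⁺ : ∀ {n} {p : Fin n → Bool} x → T (p x) → T (anyV p)
anyV⁺ {n} {p} x px = any⁺ p (lose (∈-allFin x) px)

infix 4 _∈ˢ_ _⊆ˢ_

_∈ˢ_ : ∀ {n} → Fin n → Subset n → Set
x ∈ˢ S = T (lookup S x)

_⊆ˢ_ : ∀ {n} → Subset n → Subset n → Set
S ⊆ˢ S′ = ∀ x → x ∈ˢ S → x ∈ˢ S′

∈-tabulate⁻ : ∀ {n} (f : Fin n → Bool) {x} → x ∈ˢ tabulate f → T (f x)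
∈-tabulate⁻ f {x} = subst T (lookup∘tabulate f x)

∈-tabulate⁺ : ∀ {n} (f : Fin n → Bool) {x} → T (f x) → x ∈ˢ tabulate f
∈-tabulate⁺ f {x} = subst T (sym (lookup∘tabulate f x))

∈⊤ : ∀ {n} (x : Fin n) → x ∈ˢ ⊤
∈⊤ x = subst T (sym (lookup-replicate x true)) tt

allSubsets-complete : ∀ n (S : Subset n) → S ∈ allSubsets n
allSubsets-complete zero    []          = here refl
allSubsets-complete (suc n) (true ∷ S)  = ∈-++⁺ˡ (∈-map⁺ (true ∷_) (allSubsets-complete n S))
allSubsets-complete (suc n) (false ∷ S) =
  ∈-++⁺ʳ (map (true ∷_) (allSubsets n)) (∈-map⁺ (false ∷_) (allSubsets-complete n S))

count-allSubsets : ∀ n (p : Subset (suc n) → Bool) →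
  count p (allSubsets (suc n)) ≡
  count (p ∘ (true ∷_)) (allSubsets n) + count (p ∘ (false ∷_)) (allSubsets n)
count-allSubsets n p =
  trans (count-++ p (map (true ∷_) (allSubsets n)) _)
        (cong₂ _+_ (count-map p (true ∷_) (allSubsets n)) (count-map p (false ∷_) (allSubsets n)))

count-containing : ∀ n (f : ℕ → Bool) (v : Fin (suc n)) →
  count (λ S → f ∣ S ∣ ∧ lookup S v) (allSubsets (suc n)) ≡ count (λ S → f (suc ∣ S ∣)) (allSubsets n)
count-containing n f zero = begin
    count (λ S → f ∣ S ∣ ∧ lookup S zero) (allSubsets (suc n))
  ≡⟨ count-allSubsets n (λ S → f ∣ S ∣ ∧ lookup S zero) ⟩
    count (λ S → f (suc ∣ S ∣) ∧ true) (allSubsets n) + count (λ S → f ∣ S ∣ ∧ false) (allSubsets n)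
  ≡⟨ cong₂ _+_ (count-cong (λ S → ∧-identityʳ (f (suc ∣ S ∣))) (allSubsets n))
               (trans (count-cong (λ S → ∧-zeroʳ (f ∣ S ∣)) (allSubsets n)) (count-false (allSubsets n))) ⟩
    count (λ S → f (suc ∣ S ∣)) (allSubsets n) + 0
  ≡⟨ +-identityʳ _ ⟩
    count (λ S → f (suc ∣ S ∣)) (allSubsets n)
  ∎
  where open ≡-Reasoning
count-containing (suc n) f (suc v) = begin
    count (λ S → f ∣ S ∣ ∧ lookup S (suc v)) (allSubsets (suc (suc n)))
  ≡⟨ count-allSubsets (suc n) (λ S → f ∣ S ∣ ∧ lookup S (suc v)) ⟩
    count (λ S → f (suc ∣ S ∣) ∧ lookup S v) (allSubsets (suc n)) +
    count (λ S → f ∣ S ∣ ∧ lookup S v) (allSubsets (suc n))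
  ≡⟨ cong₂ _+_ (count-containing n (f ∘ suc) v) (count-containing n f v) ⟩
    count (λ S → f (suc (suc ∣ S ∣))) (allSubsets n) + count (λ S → f (suc ∣ S ∣)) (allSubsets n)
  ≡⟨ count-allSubsets n (λ S → f (suc ∣ S ∣)) ⟨
    count (λ S → f (suc ∣ S ∣)) (allSubsets (suc n))
  ∎
  where open ≡-Reasoning

empty-subset : ∀ {n} (S : Subset n) → ∣ S ∣ ≡ 0 → ∀ x → ¬ x ∈ˢ S
empty-subset (false ∷ S) eq zero    ()
empty-subset (false ∷ S) eq (suc x) = empty-subset S eq x

nonempty-subset : ∀ {n} (S : Subset n) → 0 < ∣ S ∣ → ∃ λ x → x ∈ˢ S
nonempty-subset (true ∷ S)  _   = zero , tt
nonempty-subset (false ∷ S) pos = let (x , x∈) = nonempty-subset S pos in suc x , x∈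

singleton-subset : ∀ {n} (S : Subset n) → ∣ S ∣ ≡ 1 → ∃ λ v → ∀ x → x ∈ˢ S → x ≡ v
singleton-subset (true ∷ S)  eq = zero , only
  where
  only : ∀ x → x ∈ˢ true ∷ S → x ≡ zero
  only zero    _  = refl
  only (suc x) x∈ = ⊥-elim (empty-subset S (suc-injective eq) x x∈)
singleton-subset (false ∷ S) eq = suc v , only
  where
  v = proj₁ (singleton-subset S eq)
  only : ∀ x → x ∈ˢ false ∷ S → x ≡ suc v
  only (suc x) x∈ = cong suc (proj₂ (singleton-subset S eq) x x∈)

missing-one : ∀ {n} (S : Subset n) → ∣ S ∣ < n → ∃ λ x → ¬ x ∈ˢ S
missing-one (false ∷ S) _         = zero , λ ()
missing-one (true ∷ S)  (s≤s lt) = let (x , x∉) = missing-one S lt in suc x , x∉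

missing-two : ∀ {n} (S : Subset n) → suc ∣ S ∣ < n → ∃ λ a → ∃ λ b → a ≢ b × ¬ a ∈ˢ S × ¬ b ∈ˢ S
missing-two (false ∷ S) (s≤s lt) = let (x , x∉) = missing-one S lt in zero , suc x , (λ ()) , (λ ()) , x∉
missing-two (true ∷ S)  (s≤s lt) =
  let (a , b , a≢b , a∉ , b∉) = missing-two S lt
  in suc a , suc b , (λ eq → a≢b (Fin-suc-injective eq)) , a∉ , b∉

remove : ∀ {n} → Subset n → Fin n → Subset n
remove S x = S [ x ]≔ false

∈-remove⁺ : ∀ {n} (S : Subset n) {x y} → y ∈ˢ S → y ≢ x → y ∈ˢ remove S x
∈-remove⁺ S {x} {y} y∈ y≢x = subst T (sym (lookup∘update′ y≢x S false)) y∈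

∈-remove⁻ : ∀ {n} (S : Subset n) {x y} → y ∈ˢ remove S x → y ∈ˢ S × y ≢ x
∈-remove⁻ S {x} {y} y∈ with y ≟ x
... | yes refl = ⊥-elim (subst T (lookup∘update x S false) y∈)
... | no y≢x   = subst T (lookup∘update′ y≢x S false) y∈ , y≢x

∣remove∣ : ∀ {n} (S : Subset n) x → x ∈ˢ S → ∣ S ∣ ≡ suc ∣ remove S x ∣
∣remove∣ (true ∷ S)  zero    _  = refl
∣remove∣ (true ∷ S)  (suc x) x∈ = cong suc (∣remove∣ S x x∈)
∣remove∣ (false ∷ S) (suc x) x∈ = ∣remove∣ S x x∈

allBut₃ : ∀ {n} → Fin n → Fin n → Fin n → Subset n
allBut₃ p q r = remove (remove (remove ⊤ p) q) r

∈-allBut₃ : ∀ {n} {p q r i : Fin n} → i ≢ p → i ≢ q → i ≢ r → i ∈ˢ allBut₃ p q r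
∈-allBut₃ {p = p} {q} {r} {i} i≢p i≢q i≢r =
  ∈-remove⁺ (remove (remove ⊤ p) q) (∈-remove⁺ (remove ⊤ p) (∈-remove⁺ ⊤ (∈⊤ i) i≢p) i≢q) i≢r

allBut₃-excludes : ∀ {n} (p q r : Fin n) {i} → i ∈ˢ allBut₃ p q r → i ≢ p × i ≢ q × i ≢ r
allBut₃-excludes p q r i∈ =
  let (i∈′ , i≢r) = ∈-remove⁻ (remove (remove ⊤ p) q) i∈
      (i∈″ , i≢q) = ∈-remove⁻ (remove ⊤ p) i∈′
  in proj₂ (∈-remove⁻ ⊤ i∈″) , i≢q , i≢r

allBut₃-cover : ∀ {n} (p q r i : Fin n) → i ≡ p ⊎ i ≡ q ⊎ i ≡ r ⊎ i ∈ˢ allBut₃ p q r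
allBut₃-cover p q r i with i ≟ p | i ≟ q | i ≟ r
... | yes i≡p | _       | _       = inj₁ i≡p
... | no _    | yes i≡q | _       = inj₂ (inj₁ i≡q)
... | no _    | no _    | yes i≡r = inj₂ (inj₂ (inj₁ i≡r))
... | no i≢p  | no i≢q  | no i≢r  = inj₂ (inj₂ (inj₂ (∈-allBut₃ i≢p i≢q i≢r)))

∣allBut₃∣ : ∀ {s} {p q r : Fin (3 + s)} → p ≢ q → p ≢ r → q ≢ r → ∣ allBut₃ p q r ∣ ≡ s
∣allBut₃∣ {s} {p} {q} {r} p≢q p≢r q≢r = suc-injective (suc-injective (suc-injective (sym (begin
    3 + s                                      ≡⟨ ∣⊤∣≡n (3 + s) ⟨
    ∣ ⊤ {3 + s} ∣                              ≡⟨ ∣remove∣ ⊤ p (∈⊤ p) ⟩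
    suc ∣ remove ⊤ p ∣                          ≡⟨ cong suc (∣remove∣ (remove ⊤ p) q q∈) ⟩
    suc (suc ∣ remove (remove ⊤ p) q ∣)          ≡⟨ cong (λ m → suc (suc m)) (∣remove∣ (remove (remove ⊤ p) q) r r∈) ⟩
    suc (suc (suc ∣ allBut₃ p q r ∣))
  ∎))))
  where
  open ≡-Reasoning
  q∈ : q ∈ˢ remove (⊤ {3 + s}) p
  q∈ = ∈-remove⁺ ⊤ (∈⊤ q) (p≢q ∘ sym)
  r∈ : r ∈ˢ remove (remove (⊤ {3 + s}) p) q
  r∈ = ∈-remove⁺ (remove ⊤ p) (∈-remove⁺ ⊤ (∈⊤ r) (p≢r ∘ sym)) (q≢r ∘ sym)

fourth-vertex : ∀ {k} (p q r : Fin (4 + k)) → p ≢ q → p ≢ r → q ≢ r → ∃ λ s → p ≢ s × q ≢ s × r ≢ s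
fourth-vertex p q r p≢q p≢r q≢r =
  let (s , s∈)            = nonempty-subset (allBut₃ p q r) (subst (0 <_) (sym (∣allBut₃∣ p≢q p≢r q≢r)) (s≤s z≤n))
      (s≢p , s≢q , s≢r)   = allBut₃-excludes p q r s∈
  in s , s≢p ∘ sym , s≢q ∘ sym , s≢r ∘ sym

-- A record rather than a synonym, so that the
-- type checker never unfolds the Boolean test (which would simulate the colouring
-- process symbolically) when such a hypothesis is in scope.
record PD {n} (G : Graph n) (S : Subset n) : Set where
  constructor mkPD
  field isPD : T (isPowerDominating G S)

module PowerDomination {n : ℕ} (H : Graph n) where

  edge-sym : ∀ {u v} → T (adj H u v) → T (adj H v u)
  edge-sym {u} {v} = subst T (Graph.sym H u v)

  edge-irrefl : ∀ {u v} → T (adj H u v) → u ≢ v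
  edge-irrefl {u} e refl = subst T (Graph.irrefl H u) e

  dominated : Subset n → Fin n → Bool
  dominated S v = lookup S v ∨ anyV (λ u → lookup S u ∧ adj H u v)

  ∈-closedNbhd-self : ∀ S {v} → v ∈ˢ S → v ∈ˢ closedNbhd H S
  ∈-closedNbhd-self S {v} v∈ = ∈-tabulate⁺ (dominated S) (T-∨⁺ˡ _ v∈)

  ∈-closedNbhd-nbr : ∀ S {u v} → u ∈ˢ S → T (adj H u v) → v ∈ˢ closedNbhd H S
  ∈-closedNbhd-nbr S {u} {v} u∈ uv =
    ∈-tabulate⁺ (dominated S) (T-∨⁺ʳ (lookup S v) (anyV⁺ u (T-∧⁺ u∈ uv)))

  ∈-closedNbhd⁻ : ∀ S {v} → v ∈ˢ closedNbhd H S → v ∈ˢ S ⊎ ∃ λ u → u ∈ˢ S × T (adj H u v)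
  ∈-closedNbhd⁻ S {v} v∈ with T-∨⁻ (lookup S v) (∈-tabulate⁻ (dominated S) v∈)
  ... | inj₁ v∈S = inj₁ v∈S
  ... | inj₂ nbr = let (u , h) = anyV⁻ nbr in inj₂ (u , T-∧⁻ (lookup S u) h)

  record Forces (c : Subset n) (u v : Fin n) : Set where
    field
      forcer-coloured : u ∈ˢ c
      edge            : T (adj H u v)
      target-blank    : ¬ v ∈ˢ c
      only-blank      : ∀ w → T (adj H u w) → w ≡ v ⊎ w ∈ˢ c

  private
    gap : Subset n → Fin n → Fin n → Fin n → Bool
    gap c u v w = not (adj H u w) ∨ ⌊ w ≟ v ⌋ ∨ lookup c w

    gap⁻ : ∀ c u v w → T (gap c u v w) → T (adj H u w) → w ≡ v ⊎ w ∈ˢ c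
    gap⁻ c u v w h uw with T-∨⁻ (not (adj H u w)) h
    ... | inj₁ ¬uw = ⊥-elim (T-not⁻ ¬uw uw)
    ... | inj₂ h′ with T-∨⁻ ⌊ w ≟ v ⌋ h′
    ...   | inj₁ w≡v = inj₁ (toWitness w≡v)
    ...   | inj₂ w∈c = inj₂ w∈c

    gap⁺ : ∀ c u v w → (T (adj H u w) → w ≡ v ⊎ w ∈ˢ c) → T (gap c u v w)
    gap⁺ c u v w h with T? (adj H u w)
    ... | no ¬uw = T-∨⁺ˡ _ (T-not ¬uw)
    ... | yes uw with h uw
    ...   | inj₁ w≡v = T-∨⁺ʳ (not (adj H u w)) (T-∨⁺ˡ (lookup c w) (fromWitness {a? = w ≟ v} w≡v))
    ...   | inj₂ w∈c = T-∨⁺ʳ (not (adj H u w)) (T-∨⁺ʳ ⌊ w ≟ v ⌋ w∈c)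

  forces⁻ : ∀ c u v → T (forces H c u v) → Forces c u v
  forces⁻ c u v h =
    let (u∈ , h₁)    = T-∧⁻ (lookup c u) h
        (uv , h₂)    = T-∧⁻ (adj H u v) h₁
        (v∉ , gaps)  = T-∧⁻ (not (lookup c v)) h₂
    in record { forcer-coloured = u∈ ; edge = uv ; target-blank = T-not⁻ v∉
              ; only-blank = λ w → gap⁻ c u v w (allV⁻ gaps w) }

  forces⁺ : ∀ c u v → Forces c u v → T (forces H c u v)
  forces⁺ c u v f = T-∧⁺ forcer-coloured (T-∧⁺ edge (T-∧⁺ (T-not target-blank)
                      (allV⁺ (λ w → gap⁺ c u v w (only-blank w)))))
    where open Forces f

  forcedFrom : Subset n → Fin n → Bool
  forcedFrom c v = lookup c v ∨ anyV (λ u → forces H c u v)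

  ∈-forceStep-self : ∀ c → c ⊆ˢ forceStep H c
  ∈-forceStep-self c v v∈ = ∈-tabulate⁺ (forcedFrom c) (T-∨⁺ˡ _ v∈)

  ∈-forceStep-forced : ∀ c {u v} → Forces c u v → v ∈ˢ forceStep H c
  ∈-forceStep-forced c {u} {v} f = ∈-tabulate⁺ (forcedFrom c) (T-∨⁺ʳ (lookup c v) (anyV⁺ u (forces⁺ c u v f)))

  ∈-forceStep⁻ : ∀ c {v} → v ∈ˢ forceStep H c → v ∈ˢ c ⊎ ∃ λ u → Forces c u v
  ∈-forceStep⁻ c {v} v∈ with T-∨⁻ (lookup c v) (∈-tabulate⁻ (forcedFrom c) v∈)
  ... | inj₁ v∈c   = inj₁ v∈c
  ... | inj₂ force = let (u , f) = anyV⁻ force in inj₂ (u , forces⁻ c u v f)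

  PD⁻ : ∀ S → PD H S → ∀ v → v ∈ˢ observed H S
  PD⁻ S (mkPD pd) = allV⁻ {p = lookup (observed H S)} pd

  PD⁺ : ∀ S → (∀ v → v ∈ˢ observed H S) → PD H S
  PD⁺ S full = mkPD (allV⁺ {p = lookup (observed H S)} full)

  iterate-inflationary : ∀ k c → c ⊆ˢ iterate H k c
  iterate-inflationary zero    c v v∈ = v∈
  iterate-inflationary (suc k) c v v∈ =
    iterate-inflationary k (forceStep H c) v (∈-forceStep-self c v v∈)

  dominating⇒PD : ∀ S → (∀ v → v ∈ˢ closedNbhd H S) → PD H S
  dominating⇒PD S dom = PD⁺ S (λ v → iterate-inflationary n (closedNbhd H S) v (dom v))

  forceStep-mono : ∀ c d → c ⊆ˢ d → forceStep H c ⊆ˢ forceStep H d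
  forceStep-mono c d c⊆d v v∈ with ∈-forceStep⁻ c v∈
  ... | inj₁ v∈c = ∈-forceStep-self d v (c⊆d v v∈c)
  ... | inj₂ (u , f) with T? (lookup d v)
  ...   | yes v∈d = ∈-forceStep-self d v v∈d
  ...   | no  v∉d = ∈-forceStep-forced d record
          { forcer-coloured = c⊆d u forcer-coloured ; edge = edge ; target-blank = v∉d
          ; only-blank = λ w uw → Sum.map₂ (c⊆d w) (only-blank w uw) }
    where open Forces f

  iterate-mono : ∀ k c d → c ⊆ˢ d → iterate H k c ⊆ˢ iterate H k d
  iterate-mono zero    c d c⊆d = c⊆d
  iterate-mono (suc k) c d c⊆d = iterate-mono k _ _ (forceStep-mono c d c⊆d)

  closedNbhd-mono : ∀ S S′ → S ⊆ˢ S′ → closedNbhd H S ⊆ˢ closedNbhd H S′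
  closedNbhd-mono S S′ S⊆S′ v v∈ with ∈-closedNbhd⁻ S v∈
  ... | inj₁ v∈S            = ∈-closedNbhd-self S′ (S⊆S′ v v∈S)
  ... | inj₂ (u , u∈S , uv) = ∈-closedNbhd-nbr S′ (S⊆S′ u u∈S) uv

  PD-upward : ∀ S S′ → S ⊆ˢ S′ → PD H S → PD H S′
  PD-upward S S′ S⊆S′ pd = PD⁺ S′ λ v →
    iterate-mono n _ _ (closedNbhd-mono S S′ S⊆S′) v (PD⁻ S pd v)

  module Confined (W : Fin n → Set) (W-closed : ∀ {u x} → W u → T (adj H u x) → W x) where

    forceStep-confined : ∀ c → (∀ x → x ∈ˢ c → W x) → ∀ x → x ∈ˢ forceStep H c → W x
    forceStep-confined c c⊆W x x∈ with ∈-forceStep⁻ c x∈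
    ... | inj₁ x∈c     = c⊆W x x∈c
    ... | inj₂ (u , f) = W-closed (c⊆W u (Forces.forcer-coloured f)) (Forces.edge f)

    iterate-confined : ∀ k c → (∀ x → x ∈ˢ c → W x) → ∀ x → x ∈ˢ iterate H k c → W x
    iterate-confined zero    c c⊆W = c⊆W
    iterate-confined (suc k) c c⊆W = iterate-confined k _ (forceStep-confined c c⊆W)

    closedNbhd-confined : ∀ S → (∀ x → x ∈ˢ S → W x) → ∀ x → x ∈ˢ closedNbhd H S → W x
    closedNbhd-confined S S⊆W x x∈ with ∈-closedNbhd⁻ S x∈
    ... | inj₁ x∈S            = S⊆W x x∈S
    ... | inj₂ (u , u∈S , ux) = W-closed (S⊆W u u∈S) ux

    PD-confined : ∀ S → (∀ x → x ∈ˢ S → W x) → PD H S → ∀ x → W x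
    PD-confined S S⊆W pd x =
      iterate-confined n _ (closedNbhd-confined S S⊆W) x (PD⁻ S pd x)

  -- If every neighbour of a is also a neighbour of b (a ≠ b), then a cannot be
  -- forced while b is still blank: the forcer would see two blank neighbours.
  twin-blocks : ∀ c {a b} → a ≢ b → (∀ u → T (adj H u a) → T (adj H u b)) →
                ¬ a ∈ˢ c → ¬ b ∈ˢ c → ¬ a ∈ˢ forceStep H c
  twin-blocks c a≢b N[a]⊆N[b] a∉ b∉ a∈ with ∈-forceStep⁻ c a∈
  ... | inj₁ a∈c     = a∉ a∈c
  ... | inj₂ (u , f) with Forces.only-blank f _ (N[a]⊆N[b] u (Forces.edge f))
  ...   | inj₁ b≡a = a≢b (sym b≡a)
  ...   | inj₂ b∈c = b∉ b∈c

  twins-stay-blank : ∀ k c {a b} → a ≢ b →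
                     (∀ u → T (adj H u a) → T (adj H u b)) → (∀ u → T (adj H u b) → T (adj H u a)) →
                     ¬ a ∈ˢ c → ¬ b ∈ˢ c → ¬ a ∈ˢ iterate H k c
  twins-stay-blank zero    c a≢b ab ba a∉ b∉ = a∉
  twins-stay-blank (suc k) c a≢b ab ba a∉ b∉ =
    twins-stay-blank k (forceStep H c) a≢b ab ba
      (twin-blocks c a≢b ab a∉ b∉) (twin-blocks c (a≢b ∘ sym) ba b∉ a∉)

  last-blank-forced : ∀ c x {y} → (∀ i → i ≢ x → i ∈ˢ c) → T (adj H y x) →
                      ∀ v → v ∈ˢ forceStep H c
  last-blank-forced c x {y} almost yx v with v ≟ x
  ... | no v≢x   = ∈-forceStep-self c v (almost v v≢x)
  ... | yes refl with T? (lookup c v)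
  ...   | yes v∈ = ∈-forceStep-self c v v∈
  ...   | no  v∉ = ∈-forceStep-forced c record
          { forcer-coloured = almost y (edge-irrefl yx) ; edge = yx ; target-blank = v∉
          ; only-blank = λ w _ → Sum.map₂ (almost w) (toSum (w ≟ v)) }

  dominated-but-one : ∀ S p q r → (∀ i → i ≡ p ⊎ i ≡ q ⊎ i ≡ r ⊎ i ∈ˢ S) →
                      p ∈ˢ closedNbhd H S → q ∈ˢ closedNbhd H S → ∀ i → i ≢ r → i ∈ˢ closedNbhd H S
  dominated-but-one S p q r cover p∈ q∈ i i≢r with cover i
  ... | inj₁ refl               = p∈
  ... | inj₂ (inj₁ refl)        = q∈
  ... | inj₂ (inj₂ (inj₁ i≡r))  = ⊥-elim (i≢r i≡r)
  ... | inj₂ (inj₂ (inj₂ i∈S))  = ∈-closedNbhd-self S i∈S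

almost-dominating⇒PD : ∀ {n} (H : Graph n) S x {y} → (∀ i → i ≢ x → i ∈ˢ closedNbhd H S) →
                       T (adj H y x) → PD H S
almost-dominating⇒PD {suc n} H S x dom yx = PowerDomination.PD⁺ H S λ v →
  PowerDomination.iterate-inflationary H n _ v
    (PowerDomination.last-blank-forced H (closedNbhd H S) x dom yx v)

PD-set⇒pdCount-pos : ∀ {n} (G : Graph n) S {i} → ∣ S ∣ ≡ i → PD G S → 0 < pdCount G i
PD-set⇒pdCount-pos {n} G S {i} ∣S∣≡i pd =
  count-member (λ S → (∣ S ∣ ≡ᵇ i) ∧ isPowerDominating G S) (allSubsets n) (allSubsets-complete n S)
    (T-∧⁺ (≡⇒≡ᵇ ∣ S ∣ i ∣S∣≡i) (PD.isPD pd))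

pdCount-pos⇒PD-set : ∀ {n} (G : Graph n) i → 0 < pdCount G i → ∃ λ S → ∣ S ∣ ≡ i × PD G S
pdCount-pos⇒PD-set {n} G i pos =
  let (S , h)       = count-witness (λ S → (∣ S ∣ ≡ᵇ i) ∧ isPowerDominating G S) (allSubsets n) pos
      (size , pd)   = T-∧⁻ (∣ S ∣ ≡ᵇ i) h
  in S , ≡ᵇ⇒≡ ∣ S ∣ i size , mkPD pd

top-coefficient-pos : ∀ {n} (G : Graph n) → 0 < pdCount G n
top-coefficient-pos {n} G = PD-set⇒pdCount-pos G ⊤ (∣⊤∣≡n n)
  (PowerDomination.dominating⇒PD G ⊤ (λ v → PowerDomination.∈-closedNbhd-self G ⊤ (∈⊤ v)))

order-≤ : ∀ {m n} (H : Graph m) (G : Graph n) → SamePDPoly H G → m ≤ n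
order-≤ {zero}  H G same = z≤n
order-≤ {suc m} {n} H G same =
  let (S , ∣S∣≡ , _) = pdCount-pos⇒PD-set G (suc m) (subst (0 <_) (same (suc m)) (top-coefficient-pos H))
  in subst (_≤ n) ∣S∣≡ (∣p∣≤n S)

order-determined : ∀ {m n} (H : Graph m) (G : Graph n) → SamePDPoly H G → m ≡ n
order-determined H G same = ≤-antisym (order-≤ H G same) (order-≤ G H (λ i → sym (same i)))

module Star (m : ℕ) where
  open PowerDomination (star (suc m))

  centre-PD : ∀ S → zero ∈ˢ S → PD (star (suc m)) S
  centre-PD S 0∈ = dominating⇒PD S λ
    { zero    → ∈-closedNbhd-self S 0∈
    ; (suc v) → ∈-closedNbhd-nbr S 0∈ tt }

  leaf-neighbour : ∀ {u : Fin (suc m)} {a} → T (starAdj u (suc a)) → u ≡ zero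
  leaf-neighbour {zero} _ = refl

  leaves-twins : ∀ a b (u : Fin (suc m)) → T (starAdj u (suc a)) → T (starAdj u (suc b))
  leaves-twins a b zero _ = tt

  leaf-undominated : ∀ S a → ¬ zero ∈ˢ S → ¬ suc a ∈ˢ S → ¬ suc a ∈ˢ closedNbhd (star (suc m)) S
  leaf-undominated S a 0∉ a∉ a∈ with ∈-closedNbhd⁻ S a∈
  ... | inj₁ a∈S            = a∉ a∈S
  ... | inj₂ (u , u∈S , ua) = 0∉ (subst (_∈ˢ S) (leaf-neighbour {u} {a} ua) u∈S)

  -- A set missing the centre and two leaves is not power dominating:
  -- the two leaves are undominated twins, so neither is ever forced.
  two-leaves-missing : ∀ S {a b} → a ≢ b → ¬ zero ∈ˢ S → ¬ suc a ∈ˢ S → ¬ suc b ∈ˢ S → ¬ PD (star (suc m)) S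
  two-leaves-missing S {a} {b} a≢b 0∉ a∉ b∉ pd =
    twins-stay-blank (suc m) (closedNbhd (star (suc m)) S) (λ eq → a≢b (Fin-suc-injective eq))
      (leaves-twins a b) (leaves-twins b a) (leaf-undominated S a 0∉ a∉) (leaf-undominated S b 0∉ b∉)
      (PD⁻ S pd (suc a))

  PD⇔centre : ∀ S → suc (suc ∣ S ∣) ≤ m → isPowerDominating (star (suc m)) S ≡ lookup S zero
  PD⇔centre (true ∷ S)  _     = T⇒≡true (PD.isPD (centre-PD (true ∷ S) tt))
  PD⇔centre (false ∷ S) small =
    let (a , b , a≢b , a∉ , b∉) = missing-two S small
    in ¬T⇒≡false (two-leaves-missing (false ∷ S) a≢b (λ ()) a∉ b∉ ∘ mkPD)

  pdCount-small : ∀ i → suc (suc i) ≤ m →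
    pdCount (star (suc m)) i ≡ count (λ S → (∣ S ∣ ≡ᵇ i) ∧ lookup S zero) (allSubsets (suc m))
  pdCount-small i small = count-cong sized (allSubsets (suc m))
    where
    sized : ∀ S → (∣ S ∣ ≡ᵇ i) ∧ isPowerDominating (star (suc m)) S ≡ (∣ S ∣ ≡ᵇ i) ∧ lookup S zero
    sized S = ∧-congˡ (∣ S ∣ ≡ᵇ i) λ ∣S∣≡ᵇi →
      PD⇔centre S (subst (λ s → suc (suc s) ≤ m) (sym (≡ᵇ⇒≡ ∣ S ∣ i ∣S∣≡ᵇi)) small)

  pdCount-one-pos : 0 < pdCount (star (suc m)) 1
  pdCount-one-pos = PD-set⇒pdCount-pos (star (suc m)) (true ∷ ∅) (cong suc (∣⊥∣≡0 m)) (centre-PD (true ∷ ∅) tt)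

-- Recognising a star: a graph in which one vertex v is adjacent to all others and
-- there are no further edges is isomorphic to the star, via the swap of v and 0.
module _ {m : ℕ} where

  private
    oneOf : Bool → Bool → Bool
    oneOf p q = (p ∧ not q) ∨ (not p ∧ q)

    isCentre-nonzero : ∀ {w : Fin (suc m)} → w ≢ zero → isCentre w ≡ false
    isCentre-nonzero {zero}  w≢0 = ⊥-elim (w≢0 refl)
    isCentre-nonzero {suc w} _   = refl

    isCentre-transpose : ∀ (v i : Fin (suc m)) → isCentre (Components.transpose v zero i) ≡ ⌊ i ≟ v ⌋
    isCentre-transpose v i with i ≟ v
    ... | yes _  = refl
    ... | no i≢v with i ≟ zero
    ...   | yes refl = isCentre-nonzero (i≢v ∘ sym)
    ...   | no  i≢0  = isCentre-nonzero i≢0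

  star-recognition : ∀ (H : Graph (suc m)) v → (∀ x → x ≢ v → T (adj H v x)) →
                     (∀ x y → x ≢ v → y ≢ v → ¬ T (adj H x y)) → Isomorphic H (star (suc m))
  star-recognition H v centre-adj no-other-edge = transpose v zero , λ i j →
    trans (adj-centred i j)
          (sym (cong₂ oneOf (isCentre-transpose v i) (isCentre-transpose v j)))
    where
    adj-centred : ∀ i j → adj H i j ≡ oneOf ⌊ i ≟ v ⌋ ⌊ j ≟ v ⌋
    adj-centred i j with i ≟ v | j ≟ v
    ... | yes refl | yes refl = Graph.irrefl H v
    ... | yes refl | no j≢v   = T⇒≡true (centre-adj j j≢v)
    ... | no i≢v   | yes refl = T⇒≡true (PowerDomination.edge-sym H (centre-adj i i≢v))
    ... | no i≢v   | no j≢v   = ¬T⇒≡false (no-other-edge i j i≢v j≢v)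

module Rigidity (k : ℕ) (H : Graph (suc (3 + k))) (same : SamePDPoly H (star (suc (3 + k))))
                (v : Fin (suc (3 + k))) (S₁ : Subset (suc (3 + k)))
                (S₁⊆v : ∀ x → x ∈ˢ S₁ → x ≡ v) (S₁-PD : PD H S₁) where

  open PowerDomination H

  containing-v-PD : ∀ S → v ∈ˢ S → PD H S
  containing-v-PD S v∈ = PD-upward S₁ S (λ x x∈ → subst (_∈ˢ S) (sym (S₁⊆v x x∈)) v∈) S₁-PD

  closed-set-containing-v : (W : Fin (suc (3 + k)) → Set) → (∀ {u x} → W u → T (adj H u x) → W x) →
                            W v → ∀ x → W x
  closed-set-containing-v W W-closed Wv =
    Confined.PD-confined W W-closed S₁ (λ x x∈ → subst W (sym (S₁⊆v x x∈)) Wv) S₁-PD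

  has-neighbour : ∀ x → ∃ λ y → T (adj H y x)
  has-neighbour x with any? (λ y → T? (adj H y x))
  ... | yes nbr = nbr
  ... | no  ¬nbr with x ≟ v
  ...   | yes refl = ⊥-elim (0≢1 (trans (only-v zero) (sym (only-v (suc zero)))))
    where
    only-v : ∀ y → y ≡ v
    only-v = closed-set-containing-v (_≡ v) (λ { refl vy → ⊥-elim (¬nbr (_ , edge-sym vy)) }) refl
    0≢1 : zero ≢ suc zero
    0≢1 ()
  ...   | no  x≢v  = ⊥-elim (closed-set-containing-v (_≢ x)
                       (λ {u} _ ux y≡x → ¬nbr (u , subst (λ z → T (adj H u z)) y≡x ux)) (x≢v ∘ sym) x refl)

  -- Counting (k+1)-sets: in the star exactly those containing the centre are power
  -- dominating; in H all those containing v are.  Equal counts force equality.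
  PD-of-size-contains-v : ∀ S → ∣ S ∣ ≡ suc k → PD H S → v ∈ˢ S
  PD-of-size-contains-v S ∣S∣≡ pd with T? (lookup S v)
  ... | yes v∈ = v∈
  ... | no  v∉ = ⊥-elim (<-irrefl counts-agree
                   (count-< contains-v⇒PD (allSubsets (suc (3 + k))) (allSubsets-complete _ S)
                            (v∉ ∘ proj₂ ∘ T-∧⁻ (∣ S ∣ ≡ᵇ suc k)) (T-∧⁺ (≡⇒≡ᵇ _ _ ∣S∣≡) (PD.isPD pd))))
    where
    sized : Subset (suc (3 + k)) → Bool
    sized S = ∣ S ∣ ≡ᵇ suc k
    contains-v⇒PD : ∀ S → T (sized S ∧ lookup S v) → T (sized S ∧ isPowerDominating H S)
    contains-v⇒PD S h = let (s , v∈) = T-∧⁻ (sized S) h in T-∧⁺ s (PD.isPD (containing-v-PD S v∈))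
    counts-agree : count (λ S → sized S ∧ lookup S v) (allSubsets (suc (3 + k))) ≡ pdCount H (suc k)
    counts-agree = begin
        count (λ S → sized S ∧ lookup S v) (allSubsets (suc (3 + k)))
      ≡⟨ count-containing (3 + k) (_≡ᵇ suc k) v ⟩
        count (λ S → suc ∣ S ∣ ≡ᵇ suc k) (allSubsets (3 + k))
      ≡⟨ count-containing (3 + k) (_≡ᵇ suc k) zero ⟨
        count (λ S → sized S ∧ lookup S zero) (allSubsets (suc (3 + k)))
      ≡⟨ Star.pdCount-small (3 + k) (suc k) ≤-refl ⟨
        pdCount (star (suc (3 + k))) (suc k)
      ≡⟨ same (suc k) ⟨
        pdCount H (suc k)
      ∎
      where open ≡-Reasoning

  allBut-v-not-PD : ∀ {a c} → v ≢ a → v ≢ c → a ≢ c → ¬ PD H (allBut₃ v a c)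
  allBut-v-not-PD v≢a v≢c a≢c pd =
    proj₁ (allBut₃-excludes v _ _ (PD-of-size-contains-v _ (∣allBut₃∣ v≢a v≢c a≢c) pd)) refl

  -- Let v, a, c be distinct and let a have a neighbour b outside {v, a, c}.  Then
  -- T = V ∖ {v, a, c} dominates a, so it dominates neither v nor c: otherwise it
  -- dominates all but one vertex, and is power dominating.
  module BlindSpots {a b c : Fin (suc (3 + k))} (v≢a : v ≢ a) (v≢c : v ≢ c) (a≢c : a ≢ c)
                    (b∈T : b ∈ˢ allBut₃ v a c) (ba : T (adj H b a)) where

    private
      Tᵥ = allBut₃ v a c

      a-dominated : a ∈ˢ closedNbhd H Tᵥ
      a-dominated = ∈-closedNbhd-nbr Tᵥ b∈T ba

      v-undominated : ¬ v ∈ˢ closedNbhd H Tᵥ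
      v-undominated v∈ = allBut-v-not-PD v≢a v≢c a≢c
        (almost-dominating⇒PD H Tᵥ c (dominated-but-one Tᵥ v a c (allBut₃-cover v a c) v∈ a-dominated)
          (proj₂ (has-neighbour c)))

      c-undominated : ¬ c ∈ˢ closedNbhd H Tᵥ
      c-undominated c∈ = allBut-v-not-PD v≢a v≢c a≢c
        (almost-dominating⇒PD H Tᵥ v (dominated-but-one Tᵥ c a v cover c∈ a-dominated)
          (proj₂ (has-neighbour v)))
        where
        cover : ∀ i → i ≡ c ⊎ i ≡ a ⊎ i ≡ v ⊎ i ∈ˢ Tᵥ
        cover i with allBut₃-cover v a c i
        ... | inj₁ i≡v                = inj₂ (inj₂ (inj₁ i≡v))
        ... | inj₂ (inj₁ i≡a)         = inj₂ (inj₁ i≡a)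
        ... | inj₂ (inj₂ (inj₁ i≡c))  = inj₁ i≡c
        ... | inj₂ (inj₂ (inj₂ i∈T))  = inj₂ (inj₂ (inj₂ i∈T))

    neighbours-outside : ∀ {x u} → x ≡ v ⊎ x ≡ c → T (adj H x u) → ¬ u ∈ˢ Tᵥ
    neighbours-outside (inj₁ refl) vu u∈ = v-undominated (∈-closedNbhd-nbr Tᵥ u∈ (edge-sym vu))
    neighbours-outside (inj₂ refl) cu u∈ = c-undominated (∈-closedNbhd-nbr Tᵥ u∈ (edge-sym cu))

  -- No edge avoids v: for an edge ab, pick a fourth vertex c; by the blind-spot
  -- argument applied to both ends, {v, c} is closed under neighbours, contradicting
  -- that S₁ ⊆ {v} is power dominating.
  no-edge-avoiding-v : ∀ a b → a ≢ v → b ≢ v → ¬ T (adj H a b)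
  no-edge-avoiding-v a b a≢v b≢v ab = [ a≢v , a≢c ]′ (closed-set-containing-v W W-closed (inj₁ refl) a)
    where
    a≢b : a ≢ b
    a≢b = edge-irrefl ab
    fourth : ∃ λ c → v ≢ c × a ≢ c × b ≢ c
    fourth = fourth-vertex v a b (a≢v ∘ sym) (b≢v ∘ sym) a≢b
    c = proj₁ fourth
    v≢c = proj₁ (proj₂ fourth)
    a≢c = proj₁ (proj₂ (proj₂ fourth))
    b≢c = proj₂ (proj₂ (proj₂ fourth))

    module Bᵃ = BlindSpots (a≢v ∘ sym) v≢c a≢c (∈-allBut₃ b≢v (a≢b ∘ sym) b≢c) (edge-sym ab)
    module Bᵇ = BlindSpots (b≢v ∘ sym) v≢c b≢c (∈-allBut₃ a≢v a≢b a≢c) ab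

    W : Fin (suc (3 + k)) → Set
    W u = u ≡ v ⊎ u ≡ c

    -- a neighbour y of v or c lies in {v, a, c} ∩ {v, b, c} = {v, c}
    W-closed : ∀ {u y} → W u → T (adj H u y) → W y
    W-closed {u} {y} Wu uy with allBut₃-cover v a c y | allBut₃-cover v b c y
    ... | inj₁ y≡v               | _                           = inj₁ y≡v
    ... | inj₂ (inj₂ (inj₁ y≡c)) | _                           = inj₂ y≡c
    ... | inj₂ (inj₂ (inj₂ y∈))  | _                           = ⊥-elim (Bᵃ.neighbours-outside Wu uy y∈)
    ... | inj₂ (inj₁ _)          | inj₁ y≡v                    = inj₁ y≡v
    ... | inj₂ (inj₁ y≡a)        | inj₂ (inj₁ y≡b)             = ⊥-elim (a≢b (trans (sym y≡a) y≡b))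
    ... | inj₂ (inj₁ _)          | inj₂ (inj₂ (inj₁ y≡c))      = inj₂ y≡c
    ... | inj₂ (inj₁ _)          | inj₂ (inj₂ (inj₂ y∈))       = ⊥-elim (Bᵇ.neighbours-outside Wu uy y∈)

  v-adjacent-to-all : ∀ x → x ≢ v → T (adj H v x)
  v-adjacent-to-all x x≢v with has-neighbour x
  ... | y , yx with y ≟ v
  ...   | yes refl = yx
  ...   | no  y≢v  = ⊥-elim (no-edge-avoiding-v y x y≢v x≢v yx)

  isomorphic-to-star : Isomorphic H (star (suc (3 + k)))
  isomorphic-to-star = star-recognition H v v-adjacent-to-all no-edge-avoiding-v

-- A graph on k + 4 vertices with the power domination polynomial of S_{k+4} is
-- isomorphic to it: p(S_{k+4};1) ≥ 1 provides the power dominating set {v} of H.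
star-rigid : ∀ k (H : Graph (suc (3 + k))) → SamePDPoly H (star (suc (3 + k))) → Isomorphic H (star (suc (3 + k)))
star-rigid k H same = Rigidity.isomorphic-to-star k H same v S₁ S₁⊆v S₁-PD
  where
  PD-vertex : ∃ λ S → ∣ S ∣ ≡ 1 × PD H S
  PD-vertex = pdCount-pos⇒PD-set H 1 (subst (0 <_) (sym (same 1)) (Star.pdCount-one-pos (3 + k)))
  S₁ : Subset (suc (3 + k))
  S₁ = proj₁ PD-vertex
  S₁-PD : PD H S₁
  S₁-PD = proj₂ (proj₂ PD-vertex)
  v : Fin (suc (3 + k))
  v = proj₁ (singleton-subset S₁ (proj₁ (proj₂ PD-vertex)))
  S₁⊆v : ∀ x → x ∈ˢ S₁ → x ≡ v
  S₁⊆v = proj₂ (singleton-subset S₁ (proj₁ (proj₂ PD-vertex)))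

-- Since P(H;x) determines the order of H, this is P-uniqueness of S_{k+4}.
star-P-unique : ∀ k → PUnique (star (suc (3 + k)))
star-P-unique k m H same = rigid H (order-determined H (star (suc (3 + k))) same) same
  where
  rigid : ∀ {m} (H : Graph m) → m ≡ suc (3 + k) → SamePDPoly H (star (suc (3 + k))) →
          Isomorphic H (star (suc (3 + k)))
  rigid H refl same = star-rigid k H same

theorem26 : ∀ (n : ℕ) → 4 ≤ n → PUnique (star n)
theorem26 _ (s≤s (s≤s (s≤s (s≤s {n = k} z≤n)))) = star-P-unique k
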